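{- Let $A=\{a_1\le\dots\le a_n\}$ be a sorted multiset of positive integers and $p$ an integer with $1\le p\le n-k+1$; let $Q=\sum_{i=1}^pa_i$, $q=\max\{i\mid a_i\le Q\}$ and $x=n-q$. If $x=k-1$ and $p<q$, then it is not the case that $p$ is perfect for $A$ and the $k$-PART$_R$ instance $(A,p)$ has an optimal solution satisfying properties (1) and (2) below: (1) every set $S_i$ containing only elements $j\le q$ satisfies $\Sigma(S_i,A)<2Q$; (2) every element $j>q$ is contained in a singleton set of the solution.
   Context: $k\ge2$ is a fixed integer, $[n]=\{1,\dots,n\}$, $\Sigma(S,A)=\sum_{i\in S}a_i$. For pairwise disjoint $S_1,\dots,S_k\subseteq[n]$, with $M=\max_i\Sigma(S_i,A)$, $m=\min_i\Sigma(S_i,A)$, the ratio $\mathcal{R}(S_1,\dots,S_k,A)$ is $M/m$ if $m>0$ and $+\infty$ otherwise. $k$-PART: find pairwise disjoint $S_1,\dots,S_k\subseteq[n]$ with $\bigcup_iS_i=[n]$ minimizing $\mathcal{R}$. $k$-PART$_R$ on $(A,p)$: the same with the additional constraints $\max(S_1)=p$ and $\max(S_i)>p$ for $1<i\le k$. $p$ is perfect for $A$ if the optimal ratio of the $k$-PART$_R$ instance $(A,p)$ equals the optimal ratio of the $k$-PART instance $A$. -}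

module Defs where

open import Data.Nat using (ℕ; zero; suc; _+_; _*_; _∸_; _≤_; _<_; _⊔_; _⊓_)
open import Data.Fin using (Fin; toℕ) renaming (_≟_ to _≟ᶠ_)
open import Data.List using (List; []; _∷_; map; foldr)
open import Data.Fin.Base using () renaming (_≤_ to _≤ᶠ_)
open import Data.Product using (Σ; ∃; _×_; _,_)
open import Data.Sum using (_⊎_)
open import Relation.Nullary using (¬_; yes; no)
open import Relation.Binary.PropositionalEquality using (_≡_)

-- Conventions: an element j ∈ [n] is represented by a value j : Fin n,
-- standing for the integer toℕ j + 1.  A multiset A = {a_1,...,a_n} is a
-- function a : Fin n → ℕ.  A family of pairwise disjoint sets S_1..S_k
-- with union [n] is an assignment S : Fin n → Fin k (j ∈ S_i iff S j ≡ i);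
-- the set S_1 is the index i with toℕ i ≡ 0.

pos : ∀ {n} → Fin n → ℕ
pos j = suc (toℕ j)

sumFin : ∀ {n} → (Fin n → ℕ) → ℕ
sumFin {zero} f = 0
sumFin {suc n} f = f Data.Fin.zero + sumFin {n} (λ j → f (Data.Fin.suc j))

allFin : ∀ k → List (Fin k)
allFin zero = []
allFin (suc k) = Data.Fin.zero ∷ map Data.Fin.suc (allFin k)

maxList : List ℕ → ℕ
maxList = foldr _⊔_ 0

-- minimum of a list (value on the empty list is irrelevant; only used with k ≥ 2)
minList : List ℕ → ℕ
minList [] = 0
minList (x ∷ []) = x
minList (x ∷ y ∷ xs) = x ⊓ minList (y ∷ xs)

load : ∀ {n k} → (Fin n → ℕ) → (Fin n → Fin k) → Fin k → ℕ
load a S i = sumFin (λ j → indicator (S j ≟ᶠ i) (a j))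
  where
  indicator : ∀ {P : Set} → Relation.Nullary.Dec P → ℕ → ℕ
  indicator (yes _) v = v
  indicator (no _) v = 0

bigM : ∀ {n} k → (Fin n → ℕ) → (Fin n → Fin k) → ℕ
bigM k a S = maxList (map (load a S) (allFin k))

smallm : ∀ {n} k → (Fin n → ℕ) → (Fin n → Fin k) → ℕ
smallm k a S = minList (map (load a S) (allFin k))

-- A ratio M/m (with m = 0 meaning +∞) is represented by the pair (M , m).
-- (M , m) ≤ᵣ (M' , m')  iff  M/m ≤ M'/m'  in the extended reals.
_≤ᵣ_ : ℕ × ℕ → ℕ × ℕ → Set
(M , m) ≤ᵣ (M' , m') = m' ≡ 0 ⊎ (0 < m × M * m' ≤ M' * m)

ratio : ∀ {n} k → (Fin n → ℕ) → (Fin n → Fin k) → ℕ × ℕ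
ratio k a S = bigM k a S , smallm k a S

OptPART : ∀ {n} k → (Fin n → ℕ) → (Fin n → Fin k) → Set
OptPART {n} k a S = ∀ (T : Fin n → Fin k) → ratio k a S ≤ᵣ ratio k a T

FeasR : ∀ {n} k → ℕ → (Fin n → Fin k) → Set
FeasR {n} k p S =
  (∀ (i : Fin k) → toℕ i ≡ 0 →
     (∃ λ (j : Fin n) → S j ≡ i × pos j ≡ p) × (∀ (j : Fin n) → S j ≡ i → pos j ≤ p))
  × (∀ (i : Fin k) → ¬ (toℕ i ≡ 0) → ∃ λ (j : Fin n) → S j ≡ i × p < pos j)

OptPARTR : ∀ {n} k → (Fin n → ℕ) → ℕ → (Fin n → Fin k) → Set
OptPARTR {n} k a p S = FeasR k p S × (∀ (T : Fin n → Fin k) → FeasR k p T → ratio k a S ≤ᵣ ratio k a T)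

Perfect : ∀ {n} k → (Fin n → ℕ) → ℕ → Set
Perfect {n} k a p =
  Σ (Fin n → Fin k) λ S → Σ (Fin n → Fin k) λ T →
    OptPARTR k a p S × OptPART k a T × ratio k a S ≤ᵣ ratio k a T × ratio k a T ≤ᵣ ratio k a S

Sorted : ∀ {n} → (Fin n → ℕ) → Set
Sorted {n} a = ∀ (i j : Fin n) → i ≤ᶠ j → a i ≤ a j

Positive : ∀ {n} → (Fin n → ℕ) → Set
Positive {n} a = ∀ (i : Fin n) → 0 < a i

prefixSum : ∀ {n} → (Fin n → ℕ) → ℕ → ℕ
prefixSum a p = sumFin (λ j → keep (pos j Data.Nat.≤? p) (a j))
  where
  keep : ∀ {P : Set} → Relation.Nullary.Dec P → ℕ → ℕ
  keep (yes _) v = v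
  keep (no _) v = 0

IsMaxBelow : ∀ {n} → (Fin n → ℕ) → ℕ → ℕ → Set
IsMaxBelow {n} a Q q =
  (∃ λ (j : Fin n) → pos j ≡ q × a j ≤ Q) × (∀ (j : Fin n) → a j ≤ Q → pos j ≤ q)

Prop1 : ∀ {n} k → (Fin n → ℕ) → ℕ → ℕ → (Fin n → Fin k) → Set
Prop1 {n} k a Q q S =
  ∀ (i : Fin k) → (∀ (j : Fin n) → S j ≡ i → pos j ≤ q) → load a S i < 2 * Q

Prop2 : ∀ {n} k → ℕ → (Fin n → Fin k) → Set
Prop2 {n} k q S = ∀ (j : Fin n) → q < pos j → ∀ (j' : Fin n) → S j' ≡ S j → j' ≡ j

-- The x = k − 1 elements above q each form a singleton class by (2).  The class of q is
-- none of these, and it is not S₁ either, because every element of S₁ is at most p < q.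
-- Together with S₁ this gives k + 1 pairwise distinct classes among k.  Only feasibility
-- and (2) are used.
module Submission where

open import Defs
open import Data.Nat using (ℕ; _+_; _∸_; _≤_; _<_; suc; s≤s)
open import Data.Nat.Properties using (<⇒≱; <⇒≤; ≤-reflexive; 1+n≰n; +-cancelˡ-≡; m+[n∸m]≡n; m≤m+n)
open import Data.Fin using (Fin; toℕ; cast; _↑ʳ_) renaming (zero to fzero; suc to fsuc)
open import Data.Fin.Properties using (toℕ<n; toℕ-cast; toℕ-↑ʳ; toℕ-injective; injective⇒≤)
open import Data.Product using (Σ; ∃; _×_; _,_)
open import Data.Empty using (⊥-elim)
open import Function using (_∘_)
open import Function.Definitions using (Injective)
open import Relation.Nullary using (¬_)
open import Relation.Binary.PropositionalEquality using (_≡_; _≢_; refl; sym; trans; cong; subst; module ≡-Reasoning)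

module _ {n q : ℕ} (q≤n : q ≤ n) where

  above : Fin (n ∸ q) → Fin n
  above i = cast (m+[n∸m]≡n q≤n) (q ↑ʳ i)

  toℕ-above : ∀ i → toℕ (above i) ≡ q + toℕ i
  toℕ-above i = trans (toℕ-cast _ (q ↑ʳ i)) (toℕ-↑ʳ q i)

  q<pos-above : ∀ i → q < pos (above i)
  q<pos-above i = subst (q <_) (sym (cong suc (toℕ-above i))) (s≤s (m≤m+n q (toℕ i)))

  above-injective : Injective _≡_ _≡_ above
  above-injective {i} {j} eq = toℕ-injective (+-cancelˡ-≡ q _ _ (begin
    q + toℕ i      ≡⟨ toℕ-above i ⟨
    toℕ (above i)  ≡⟨ cong toℕ eq ⟩
    toℕ (above j)  ≡⟨ toℕ-above j ⟩
    q + toℕ j      ∎))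
    where open ≡-Reasoning

module _ {n k q : ℕ} {S : Fin n → Fin k} (singletons : Prop2 k q S) where

  Prop2⇒class≢ : ∀ {j j'} → q < pos j → pos j' ≤ q → S j' ≢ S j
  Prop2⇒class≢ q<j j'≤q eq = <⇒≱ q<j (subst (_≤ q) (cong pos (singletons _ q<j _ eq)) j'≤q)

  Prop2⇒above-classes-injective : (q≤n : q ≤ n) → Injective _≡_ _≡_ (S ∘ above q≤n)
  Prop2⇒above-classes-injective q≤n {i} {j} eq =
    above-injective q≤n (singletons _ (q<pos-above q≤n j) _ eq)

module _ {n k q : ℕ} {S : Fin n → Fin k} (singletons : Prop2 k q S) (q≤n : q ≤ n)
         {j₁ j₂ : Fin n} (j₁≤q : pos j₁ ≤ q) (j₂≤q : pos j₂ ≤ q) (classes≢ : S j₁ ≢ S j₂) where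

  witness : Fin (2 + (n ∸ q)) → Fin n
  witness fzero = j₁
  witness (fsuc fzero) = j₂
  witness (fsuc (fsuc i)) = above q≤n i

  witness-classes-injective : Injective _≡_ _≡_ (S ∘ witness)
  witness-classes-injective {fzero} {fzero} _ = refl
  witness-classes-injective {fzero} {fsuc fzero} eq = ⊥-elim (classes≢ eq)
  witness-classes-injective {fzero} {fsuc (fsuc j)} eq =
    ⊥-elim (Prop2⇒class≢ singletons (q<pos-above q≤n j) j₁≤q eq)
  witness-classes-injective {fsuc fzero} {fzero} eq = ⊥-elim (classes≢ (sym eq))
  witness-classes-injective {fsuc fzero} {fsuc fzero} _ = refl
  witness-classes-injective {fsuc fzero} {fsuc (fsuc j)} eq =
    ⊥-elim (Prop2⇒class≢ singletons (q<pos-above q≤n j) j₂≤q eq)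
  witness-classes-injective {fsuc (fsuc i)} {fzero} eq =
    ⊥-elim (Prop2⇒class≢ singletons (q<pos-above q≤n i) j₁≤q (sym eq))
  witness-classes-injective {fsuc (fsuc i)} {fsuc fzero} eq =
    ⊥-elim (Prop2⇒class≢ singletons (q<pos-above q≤n i) j₂≤q (sym eq))
  witness-classes-injective {fsuc (fsuc i)} {fsuc (fsuc j)} eq =
    cong (fsuc ∘ fsuc) (Prop2⇒above-classes-injective singletons q≤n eq)

  Prop2⇒2+[n∸q]≤k : 2 + (n ∸ q) ≤ k
  Prop2⇒2+[n∸q]≤k = injective⇒≤ witness-classes-injective

FeasR⇒S₁-bounded : ∀ {n k p} {S : Fin n → Fin (suc k)} → FeasR (suc k) p S →
  ∃ λ jp → pos jp ≡ p × (∀ j → S j ≡ S jp → pos j ≤ p)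
FeasR⇒S₁-bounded (S₁-max , _) with (jp , S-jp , pos-jp) , bounded ← S₁-max fzero refl =
  jp , pos-jp , λ j eq → bounded j (trans eq S-jp)

lemma20 : (k : ℕ) → 2 ≤ k → (n : ℕ) → (a : Fin n → ℕ) → Sorted a → Positive a →
    (p : ℕ) → 1 ≤ p → p + k ≤ n + 1 →
    (Q q : ℕ) → Q ≡ prefixSum a p → IsMaxBelow a Q q →
    n ∸ q ≡ k ∸ 1 → p < q →
    ¬ (Perfect k a p × Σ (Fin n → Fin k) λ S → OptPARTR k a p S × Prop1 k a Q q S × Prop2 k q S)
lemma20 (suc k) (s≤s _) n a _ _ p _ _ Q q _ ((jq , pos-jq , _) , _) x≡k-1 p<q
        (_ , S , (feasible , _) , _ , singletons)
  with jp , pos-jp , S₁-bounded ← FeasR⇒S₁-bounded feasible =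
  1+n≰n (subst (λ x → 2 + x ≤ suc k) x≡k-1
          (Prop2⇒2+[n∸q]≤k singletons q≤n jp≤q (≤-reflexive pos-jq) class-jp≢class-jq))
  where
  q≤n : q ≤ n
  q≤n = subst (_≤ n) pos-jq (toℕ<n jq)
  jp≤q : pos jp ≤ q
  jp≤q = subst (_≤ q) (sym pos-jp) (<⇒≤ p<q)
  class-jp≢class-jq : S jp ≢ S jq
  class-jp≢class-jq eq = <⇒≱ p<q (subst (_≤ p) pos-jq (S₁-bounded jq (sym eq)))
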